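{- Let $\mu=(\mu_0\geq\mu_1\geq\cdots\geq\mu_\ell\geq 1)$ be an integer partition with $\ell\geq 1$, and let $1\leq d\leq\mu_0$. Let $P_{\mu,d,n}(t)=\sum_{w\in\mathcal{A}_\mu(d,n)}t^{\mathrm{bigtiles}(w)}$, $\mathbf{F}_{\mu,d}(x,t)=\sum_{n\geq0}P_{\mu,d,n}(t)x^n$, and $B_{\mu,d}(x,t)=\sum_{w}x^{\mathrm{width}(w)}t^{\mathrm{bigtiles}(w)}$, where the last sum is over all fault-free anchor words $w$ for $\mu$ (of any length). Then \[ \mathbf{F}_{\mu,d}(x,t)=\frac{1}{1-B_{\mu,d}(x,t)}. \] In particular, writing $\alpha_j(t)\in\mathbb{N}[t]$ for the sum of $t^{\mathrm{bigtiles}(w)}$ over fault-free anchor words $w$ of length $j$, we have $\alpha_1=1$, $\alpha_j=0$ for $j>\ell d+1$, and for all $n\geq1$ (with $P_{\mu,d,m}=0$ for $m<0$) \[ P_{\mu,d,n}(t)=\sum_{j=1}^{\ell d+1}\alpha_j(t)\,P_{\mu,d,n-j}(t), \] a linear recursion of length at most $\ell d+1$ with coefficients in $\mathbb{N}[t]$.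
   Context: An anchor word for $\mu$ of length $n$ (with parameter $d$) is a word $a_1\cdots a_n$ over $\{1,\dotsc,d,\infty\}$ such that for every $i$ with $a_i\neq\infty$, $a_{i+k}\geq a_i+\mu_k$ for all $k=1,\dotsc,\ell$ ($\infty$ larger than every integer), and $a_{n-\ell+1}=\cdots=a_n=\infty$; $\mathcal{A}_\mu(d,n)$ is the set of these (the empty word for $n=0$). $\mathrm{bigtiles}(w)$ is the number of letters of $w$ different from $\infty$ and $\mathrm{width}(w)$ is the length of $w$. An anchor word is fault-free if it is either the one-letter word $(\infty)$, or it starts with an integer letter, ends with $\ell$ consecutive letters $\infty$, and this final block is the only occurrence of $\ell$ consecutive $\infty$'s in it. (These correspond to tilings of the board with $\mu_0+d-1$ rows by unit squares and translates of the Ferrers tile of $\mu$, the tile with bottom-justified columns of heights $\mu_0,\dotsc,\mu_\ell$, placing a tile with lower-left cell in column $i$, row $a_i$; fault-free words correspond to tilings with no vertical fault line.) -}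

module Defs where

open import Data.Nat using (ℕ; zero; suc; _+_; _*_; _∸_; _≤_; _<_; _≤ᵇ_; _≡ᵇ_)
open import Data.Bool using (Bool; true; false; _∧_; _∨_; not; if_then_else_)
open import Data.List using (List; []; _∷_; length; map; concatMap; upTo; applyUpTo; allFin; filterᵇ)
open import Data.Maybe using (Maybe; just; nothing)
open import Data.Fin using (Fin; inject₁; fromℕ; toℕ)
import Data.Fin as F
open import Data.Vec using (Vec; lookup)
open import Data.Integer using (ℤ; +_) renaming (_+_ to _+ℤ_; _*_ to _*ℤ_; _-_ to _-ℤ_)

IsPartition : (ℓ : ℕ) → Vec ℕ (suc ℓ) → Set
IsPartition ℓ μ =
  ((i : Fin ℓ) → lookup μ (F.suc i) ≤ lookup μ (inject₁ i))
  × (1 ≤ lookup μ (fromℕ ℓ))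
  where open import Data.Product using (_×_)

all : {A : Set} → (A → Bool) → List A → Bool
all p []       = true
all p (x ∷ xs) = p x ∧ all p xs

-- Letters: an integer letter  fin a  (a ∈ {1,…,d}), or  ∞

data Letter : Set where
  fin : ℕ → Letter
  ∞   : Letter

isInf : Letter → Bool
isInf ∞       = true
isInf (fin _) = false

geqL : Letter → ℕ → Bool
geqL ∞       m = true
geqL (fin a) m = m ≤ᵇ a

alphabet : ℕ → List Letter
alphabet d = ∞ ∷ applyUpTo (λ i → fin (suc i)) d

words : ℕ → ℕ → List (List Letter)
words d zero    = [] ∷ []
words d (suc n) = concatMap (λ a → map (a ∷_) (words d n)) (alphabet d)

_!!_ : List Letter → ℕ → Maybe Letter
[]      !! i       = nothing
(a ∷ w) !! zero    = just a
(a ∷ w) !! (suc i) = w !! i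

-- Anchor words (positions 0-indexed: a_{i+1} is  w !! i)

condAt : (ℓ : ℕ) → Vec ℕ (suc ℓ) → List Letter → ℕ → Bool
condAt ℓ μ w i with w !! i
... | just (fin v) =
      all (λ (k : Fin ℓ) → check (w !! (i + suc (toℕ k))) (v + lookup μ (F.suc k)))
          (allFin ℓ)
  where
  check : Maybe Letter → ℕ → Bool
  check (just b) m = geqL b m
  check nothing  m = false
... | _ = true

trailingInf : ℕ → List Letter → Bool
trailingInf ℓ w = all (λ j → (length w ∸ ℓ ≤ᵇ j) ⇒ᵇ isInfM (w !! j)) (upTo (length w))
  where
  _⇒ᵇ_ : Bool → Bool → Bool
  b ⇒ᵇ c = not b ∨ c
  isInfM : Maybe Letter → Bool
  isInfM (just a) = isInf a
  isInfM nothing  = false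

isAnchor : (ℓ : ℕ) → Vec ℕ (suc ℓ) → List Letter → Bool
isAnchor ℓ μ w = all (condAt ℓ μ w) (upTo (length w)) ∧ trailingInf ℓ w

bigtiles : List Letter → ℕ
bigtiles []          = 0
bigtiles (∞ ∷ w)     = bigtiles w
bigtiles (fin _ ∷ w) = suc (bigtiles w)

width : List Letter → ℕ
width = length

infBlock : ℕ → List Letter → ℕ → Bool
infBlock ℓ w j = all (λ t → isInfM (w !! (j + t))) (upTo ℓ)
  where
  isInfM : Maybe Letter → Bool
  isInfM (just a) = isInf a
  isInfM nothing  = false

startsFin : List Letter → Bool
startsFin (fin _ ∷ _) = true
startsFin _           = false

isSingleInf : List Letter → Bool
isSingleInf (∞ ∷ []) = true
isSingleInf _        = false

isFaultFree : ℕ → List Letter → Bool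
isFaultFree ℓ w =
  isSingleInf w ∨
  (startsFin w ∧ (ℓ ≤ᵇ length w) ∧ infBlock ℓ w (length w ∸ ℓ)
   ∧ all (λ j → not (infBlock ℓ w j) ∨ (j ≡ᵇ (length w ∸ ℓ))) (upTo (length w)))

-- P μ d n k = [t^k] P_{μ,d,n}(t) = #{ w ∈ A_μ(d,n) : bigtiles w = k }
P : (ℓ : ℕ) → Vec ℕ (suc ℓ) → ℕ → ℕ → ℕ → ℕ
P ℓ μ d n k = length (filterᵇ (λ w → isAnchor ℓ μ w ∧ (bigtiles w ≡ᵇ k)) (words d n))

-- α μ d j k = [t^k] α_j(t) = #{ fault-free w ∈ A_μ(d,j) : bigtiles w = k }
α : (ℓ : ℕ) → Vec ℕ (suc ℓ) → ℕ → ℕ → ℕ → ℕ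
α ℓ μ d j k =
  length (filterᵇ (λ w → isAnchor ℓ μ w ∧ isFaultFree ℓ w ∧ (bigtiles w ≡ᵇ k)) (words d j))

-- Formal power series in x, t over ℤ:  f n k = [x^n t^k] f

Series : Set
Series = ℕ → ℕ → ℤ

sumℤ≤ : ℕ → (ℕ → ℤ) → ℤ
sumℤ≤ zero    f = f 0
sumℤ≤ (suc n) f = sumℤ≤ n f +ℤ f (suc n)

_*ˢ_ : Series → Series → Series
(f *ˢ g) n k = sumℤ≤ n (λ a → sumℤ≤ k (λ b → f a b *ℤ g (n ∸ a) (k ∸ b)))

_-ˢ_ : Series → Series → Series
(f -ˢ g) n k = f n k -ℤ g n k

oneˢ : Series
oneˢ zero zero = + 1
oneˢ _    _    = + 0

Fser : (ℓ : ℕ) → Vec ℕ (suc ℓ) → ℕ → Series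
Fser ℓ μ d n k = + P ℓ μ d n k

Bser : (ℓ : ℕ) → Vec ℕ (suc ℓ) → ℕ → Series
Bser ℓ μ d n k = + α ℓ μ d n k

-- Polynomials in ℕ[t] as coefficient functions

Poly : Set
Poly = ℕ → ℕ

sum≤ : ℕ → (ℕ → ℕ) → ℕ
sum≤ zero    f = f 0
sum≤ (suc n) f = sum≤ n f + f (suc n)

_·ₚ_ : Poly → Poly → Poly
(p ·ₚ q) k = sum≤ k (λ i → p i * q (k ∸ i))

sum1to : ℕ → (ℕ → Poly) → Poly
sum1to zero    f k = 0
sum1to (suc m) f k = sum1to m f k + f (suc m) k

-- P_{μ,d,n-j}(t), taken to be 0 when n - j < 0
Pshift : (ℓ : ℕ) → Vec ℕ (suc ℓ) → ℕ → ℕ → ℕ → Poly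
Pshift ℓ μ d n j k = if j ≤ᵇ n then P ℓ μ d (n ∸ j) k else 0

oneₚ : Poly
oneₚ zero    = 1
oneₚ (suc _) = 0

{-# OPTIONS --safe #-}
module Submission where

-- Every nonempty anchor word w factors uniquely as w = u v with u a fault-free anchor word and
-- v an anchor word: u is the letter ∞ if w starts with ∞, and otherwise ends with the first
-- block of ℓ consecutive ∞'s of w.  Counting by width and big tiles, this is
-- P_n = Σ_j α_j P_{n-j} for n ≥ 1, i.e. F = 1 + B F.  Fault-free words are short: after a
-- finite letter a, either the next ℓ letters are all ∞, and then they are the final block, or
-- one of them is a finite letter ≥ a + μ_k > a; as letters lie in 1..d, the width is at most
-- ℓ (d - 1) + ℓ + 1 = ℓ d + 1.

open import Defs
open import Data.Nat using (ℕ; suc; _+_; _*_; _≤_; _<_)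
open import Data.Vec using (Vec; lookup)
open import Data.Fin using (zero)
open import Data.Product using (_×_)
open import Relation.Binary.PropositionalEquality using (_≡_)

open import Data.Bool using (Bool; true; false; _∧_; _∨_; not; T; if_then_else_)
open import Data.Bool.Properties using (T?; T-∧; T-∨; T-≡)
open import Data.Empty using (⊥-elim)
open import Data.Fin using (Fin; toℕ)
import Data.Fin as F
open import Data.Fin.Induction using (>-weakInduction)
open import Data.Fin.Properties using (toℕ<n; toℕ-fromℕ<)
open import Data.Integer using (ℤ; +_) renaming (_+_ to _+ℤ_; _*_ to _*ℤ_; _-_ to _-ℤ_)
open import Data.Integer.Properties using (pos-+; pos-*; +-inverseʳ)
open import Data.Integer.Tactic.RingSolver using (solve-∀)
open import Data.List using (List; []; _∷_; _++_; length; map; concatMap; filterᵇ; take; drop; applyUpTo; upTo; allFin)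
open import Data.List.Properties using (map-++; map-∘; map-cong; map-cong-local; length-take; length-drop)
open import Data.List.Relation.Unary.All as All using (All; []; _∷_)
open import Data.List.Relation.Unary.All.Properties
  using (concat⁺; map⁺; applyUpTo⁺₁; applyUpTo⁺₂; applyUpTo⁻; tabulate⁻; ¬All⇒Any¬)
open import Data.List.Relation.Unary.Any using (Any)
import Data.List.Relation.Unary.Any.Properties as Any
open import Data.Maybe using (just; nothing)
open import Data.Nat using (zero; _∸_; _≤ᵇ_; _≡ᵇ_; z≤n; s≤s)
open import Data.Nat.Induction using (<-wellFounded)
open import Data.Nat.ListAction using (sum)
open import Data.Nat.ListAction.Properties using (sum-++)
open import Data.Nat.Properties
import Data.Nat.Tactic.RingSolver as ℕ-Solver
open import Data.Product using (_,_; proj₁; proj₂; ∃-syntax)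
open import Data.Sum using (_⊎_; inj₁; inj₂)
open import Data.Unit using (⊤; tt)
open import Function using (_∘_)
open import Function.Bundles using (Equivalence; _⇔_; mk⇔)
open import Induction.WellFounded using (Acc; acc)
open import Relation.Binary.PropositionalEquality using (refl; sym; trans; cong; cong₂; subst; _≢_; module ≡-Reasoning)
open import Relation.Nullary using (¬_; yes; no)

open Equivalence using (to; from)

-- Indicators and finite sums

𝟙 : Bool → ℕ
𝟙 true  = 1
𝟙 false = 0

𝟙-∧ : ∀ a b → 𝟙 (a ∧ b) ≡ 𝟙 a * 𝟙 b
𝟙-∧ true  b = sym (+-identityʳ (𝟙 b))
𝟙-∧ false b = refl

𝟙-T : ∀ {b} → T b → 𝟙 b ≡ 1
𝟙-T {true} _ = refl

𝟙-¬T : ∀ {b} → ¬ T b → 𝟙 b ≡ 0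
𝟙-¬T {true}  ¬b = ⊥-elim (¬b tt)
𝟙-¬T {false} ¬b = refl

𝟙-∧-regroup : ∀ a f c b e → 𝟙 (a ∧ f ∧ c) * 𝟙 (b ∧ e) ≡ 𝟙 (a ∧ f ∧ b) * (𝟙 c * 𝟙 e)
𝟙-∧-regroup true  true  c true  e = sym (+-identityʳ _)
𝟙-∧-regroup true  true  c false e = *-zeroʳ (𝟙 c)
𝟙-∧-regroup true  false c b     e = refl
𝟙-∧-regroup false f     c b     e = refl

T-∧³ : ∀ a b c → T (a ∧ b ∧ c) ⇔ (T a × T b × T c)
T-∧³ a b c = mk⇔ (λ h → let ta , tbc = to (T-∧ {a}) h in ta , to (T-∧ {b} {c}) tbc)
                 (λ (ta , tb , tc) → from (T-∧ {a}) (ta , from (T-∧ {b} {c}) (tb , tc)))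

if-T : ∀ {A : Set} {b} {x y : A} → T b → (if b then x else y) ≡ x
if-T {b = true} _ = refl

if-¬T : ∀ {A : Set} {b} {x y : A} → ¬ T b → (if b then x else y) ≡ y
if-¬T {b = true}  ¬b = ⊥-elim (¬b tt)
if-¬T {b = false} _  = refl

all⇒All : ∀ {A : Set} (p : A → Bool) xs → T (all p xs) → All (T ∘ p) xs
all⇒All p []       _ = []
all⇒All p (x ∷ xs) h = proj₁ (to T-∧ h) ∷ all⇒All p xs (proj₂ (to T-∧ h))

All⇒all : ∀ {A : Set} (p : A → Bool) {xs} → All (T ∘ p) xs → T (all p xs)
All⇒all p []         = tt
All⇒all p (px ∷ pxs) = from T-∧ (px , All⇒all p pxs)

¬all⇒Any¬ : ∀ {A : Set} (p : A → Bool) xs → ¬ T (all p xs) → Any (λ x → ¬ T (p x)) xs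
¬all⇒Any¬ p xs ¬h = ¬All⇒Any¬ (T? ∘ p) xs (¬h ∘ All⇒all p)

length-filterᵇ : ∀ {A : Set} (p : A → Bool) xs → length (filterᵇ p xs) ≡ sum (map (𝟙 ∘ p) xs)
length-filterᵇ p []       = refl
length-filterᵇ p (x ∷ xs) with p x
... | true  = cong suc (length-filterᵇ p xs)
... | false = length-filterᵇ p xs

sum-map-+ : ∀ {A : Set} (f g : A → ℕ) xs →
            sum (map (λ x → f x + g x) xs) ≡ sum (map f xs) + sum (map g xs)
sum-map-+ f g []       = refl
sum-map-+ f g (x ∷ xs) = trans (cong (_+_ (f x + g x)) (sum-map-+ f g xs))
                               (+-interchange (f x) (g x) _ _)
  where open import Algebra.Properties.CommutativeSemigroup +-commutativeSemigroup
          renaming (interchange to +-interchange)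

sum-map-*ˡ : ∀ {A : Set} c (f : A → ℕ) xs → sum (map (λ x → c * f x) xs) ≡ c * sum (map f xs)
sum-map-*ˡ c f []       = sym (*-zeroʳ c)
sum-map-*ˡ c f (x ∷ xs) = trans (cong (_+_ (c * f x)) (sum-map-*ˡ c f xs)) (sym (*-distribˡ-+ c (f x) _))

sum-map-*ʳ : ∀ {A : Set} c (f : A → ℕ) xs → sum (map (λ x → f x * c) xs) ≡ sum (map f xs) * c
sum-map-*ʳ c f []       = refl
sum-map-*ʳ c f (x ∷ xs) = trans (cong (_+_ (f x * c)) (sum-map-*ʳ c f xs)) (sym (*-distribʳ-+ c (f x) _))

sum-map-zero : ∀ {A : Set} (xs : List A) → sum (map (λ _ → 0) xs) ≡ 0
sum-map-zero []       = refl
sum-map-zero (x ∷ xs) = sum-map-zero xs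

sum-map-concatMap : ∀ {A B : Set} (f : B → ℕ) (g : A → List B) xs →
                    sum (map f (concatMap g xs)) ≡ sum (map (λ x → sum (map f (g x))) xs)
sum-map-concatMap f g []       = refl
sum-map-concatMap f g (x ∷ xs) = begin
  sum (map f (g x ++ concatMap g xs))              ≡⟨ cong sum (map-++ f (g x) _) ⟩
  sum (map f (g x) ++ map f (concatMap g xs))      ≡⟨ sum-++ (map f (g x)) _ ⟩
  sum (map f (g x)) + sum (map f (concatMap g xs)) ≡⟨ cong (_+_ (sum (map f (g x)))) (sum-map-concatMap f g xs) ⟩
  sum (map (λ y → sum (map f (g y))) (x ∷ xs))     ∎
  where open ≡-Reasoning

sum≤-cong : ∀ n {f g : ℕ → ℕ} → (∀ {i} → i ≤ n → f i ≡ g i) → sum≤ n f ≡ sum≤ n g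
sum≤-cong zero    h = h z≤n
sum≤-cong (suc n) h = cong₂ _+_ (sum≤-cong n (h ∘ m≤n⇒m≤1+n)) (h ≤-refl)

sum≤-zero : ∀ n {f : ℕ → ℕ} → (∀ {i} → i ≤ n → f i ≡ 0) → sum≤ n f ≡ 0
sum≤-zero zero    h = h z≤n
sum≤-zero (suc n) h = cong₂ _+_ (sum≤-zero n (h ∘ m≤n⇒m≤1+n)) (h ≤-refl)

sum≤-single : ∀ n {f : ℕ → ℕ} a → a ≤ n → (∀ {i} → i ≤ n → i ≢ a → f i ≡ 0) → sum≤ n f ≡ f a
sum≤-single zero    zero z≤n _ = refl
sum≤-single (suc n) {f} a a≤1+n h with a ≟ suc n
... | yes refl = cong (_+ f (suc n)) (sum≤-zero n (λ i≤n → h (m≤n⇒m≤1+n i≤n) λ { refl → 1+n≰n i≤n }))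
... | no a≢1+n = begin
  sum≤ n f + f (suc n) ≡⟨ cong₂ _+_ (sum≤-single n a (≤-pred (≤∧≢⇒< a≤1+n a≢1+n)) (h ∘ m≤n⇒m≤1+n))
                                    (h ≤-refl (a≢1+n ∘ sym)) ⟩
  f a + 0              ≡⟨ +-identityʳ (f a) ⟩
  f a                  ∎
  where open ≡-Reasoning

sum≤-*ˡ : ∀ n c (f : ℕ → ℕ) → sum≤ n (λ i → c * f i) ≡ c * sum≤ n f
sum≤-*ˡ zero    c f = refl
sum≤-*ˡ (suc n) c f = trans (cong (_+ c * f (suc n)) (sum≤-*ˡ n c f)) (sym (*-distribˡ-+ c _ _))

sum≤-*ʳ : ∀ n c (f : ℕ → ℕ) → sum≤ n (λ i → f i * c) ≡ sum≤ n f * c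
sum≤-*ʳ zero    c f = refl
sum≤-*ʳ (suc n) c f = trans (cong (_+ f (suc n) * c) (sum≤-*ʳ n c f)) (sym (*-distribʳ-+ c (sum≤ n f) (f (suc n))))

sum≤-suc : ∀ n (f : ℕ → ℕ) → sum≤ (suc n) f ≡ f 0 + sum≤ n (f ∘ suc)
sum≤-suc zero    f = refl
sum≤-suc (suc n) f = trans (cong (_+ f (suc (suc n))) (sum≤-suc n f)) (+-assoc (f 0) _ _)

sum≤-reverse : ∀ n (f : ℕ → ℕ) → sum≤ n (λ i → f (n ∸ i)) ≡ sum≤ n f
sum≤-reverse zero    f = refl
sum≤-reverse (suc n) f = begin
  sum≤ (suc n) (λ i → f (suc n ∸ i)) ≡⟨ sum≤-suc n (λ i → f (suc n ∸ i)) ⟩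
  f (suc n) + sum≤ n (λ i → f (n ∸ i)) ≡⟨ cong (_+_ (f (suc n))) (sum≤-reverse n f) ⟩
  f (suc n) + sum≤ n f                 ≡⟨ +-comm (f (suc n)) _ ⟩
  sum≤ (suc n) f                       ∎
  where open ≡-Reasoning

sum≤-+-vanishing : ∀ m e {f : ℕ → ℕ} → (∀ {j} → m < j → f j ≡ 0) → sum≤ (m + e) f ≡ sum≤ m f
sum≤-+-vanishing m zero    h = cong (λ n → sum≤ n _) (+-identityʳ m)
sum≤-+-vanishing m (suc e) {f} h = begin
  sum≤ (m + suc e) f       ≡⟨ cong (λ n → sum≤ n f) (+-suc m e) ⟩
  sum≤ (m + e) f + f (suc (m + e)) ≡⟨ cong₂ _+_ (sum≤-+-vanishing m e h) (h (s≤s (m≤m+n m e))) ⟩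
  sum≤ m f + 0             ≡⟨ +-identityʳ _ ⟩
  sum≤ m f                 ∎
  where open ≡-Reasoning

sum≤≡head+sum1to : ∀ m (F : ℕ → Poly) k → sum≤ m (λ j → F j k) ≡ F 0 k + sum1to m F k
sum≤≡head+sum1to zero    F k = sym (+-identityʳ (F 0 k))
sum≤≡head+sum1to (suc m) F k = trans (cong (_+ F (suc m) k) (sum≤≡head+sum1to m F k)) (+-assoc (F 0 k) _ _)

sum-map-sum≤ : ∀ {A : Set} m (F : ℕ → A → ℕ) xs →
               sum (map (λ x → sum≤ m (λ j → F j x)) xs) ≡ sum≤ m (λ j → sum (map (F j) xs))
sum-map-sum≤ zero    F xs = refl
sum-map-sum≤ (suc m) F xs = trans (sum-map-+ (λ x → sum≤ m (λ j → F j x)) (F (suc m)) xs)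
                                  (cong (_+ sum (map (F (suc m)) xs)) (sum-map-sum≤ m F xs))

sum≤-reflect : ∀ n (F : ℕ → ℕ → ℕ) → sum≤ n (λ i → F i (n ∸ i)) ≡ sum≤ n (λ i → F (n ∸ i) i)
sum≤-reflect n F = begin
  sum≤ n (λ i → F i (n ∸ i))               ≡⟨ sum≤-reverse n (λ i → F i (n ∸ i)) ⟨
  sum≤ n (λ i → F (n ∸ i) (n ∸ (n ∸ i)))   ≡⟨ sum≤-cong n (λ i≤n → cong (F _) (m∸[m∸n]≡n i≤n)) ⟩
  sum≤ n (λ i → F (n ∸ i) i)               ∎
  where open ≡-Reasoning

∸-∸-comm : ∀ m n o → m ∸ n ∸ o ≡ m ∸ o ∸ n
∸-∸-comm m n o = trans (∸-+-assoc m n o) (trans (cong (m ∸_) (+-comm n o)) (sym (∸-+-assoc m o n)))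

o<n∸m⇒m+o<n : ∀ m {n o} → o < n ∸ m → m + o < n
o<n∸m⇒m+o<n zero            o<n   = o<n
o<n∸m⇒m+o<n (suc m) {suc n} o<n∸m = s≤s (o<n∸m⇒m+o<n m o<n∸m)

m∸n∸o≤x⇒m∸o≤n+x : ∀ m n o {x} → m ∸ n ∸ o ≤ x → m ∸ o ≤ n + x
m∸n∸o≤x⇒m∸o≤n+x m n o {x} h = ≤-trans (m≤n+m∸n (m ∸ o) n) (+-monoʳ-≤ n (subst (_≤ x) (∸-∸-comm m n o) h))

m+[ℓ∸1]<n+ℓ⇒m≤n : ∀ {ℓ m n} → 1 ≤ ℓ → m + (ℓ ∸ 1) < n + ℓ → m ≤ n
m+[ℓ∸1]<n+ℓ⇒m≤n {ℓ} {m} {n} ℓ≥1 lt = +-cancelʳ-≤ ℓ m n (subst (_≤ n + ℓ) m+ℓ lt)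
  where
  m+ℓ : suc (m + (ℓ ∸ 1)) ≡ m + ℓ
  m+ℓ = trans (sym (+-suc m (ℓ ∸ 1))) (cong (_+_ m) (m+[n∸m]≡n ℓ≥1))

n∸1<n : ∀ {n} → 1 ≤ n → n ∸ 1 < n
n∸1<n {n} n≥1 = subst (n ∸ 1 <_) (m+[n∸m]≡n n≥1) ≤-refl

p+s+ℓ*x≤p+ℓ*y : ∀ ℓ p {s x y} → s ≤ ℓ → x < y → p + s + ℓ * x ≤ p + ℓ * y
p+s+ℓ*x≤p+ℓ*y ℓ p {s} {x} {y} s≤ℓ x<y = begin
  p + s + ℓ * x    ≡⟨ +-assoc p s (ℓ * x) ⟩
  p + (s + ℓ * x)  ≤⟨ +-monoʳ-≤ p (+-monoˡ-≤ (ℓ * x) s≤ℓ) ⟩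
  p + (ℓ + ℓ * x)  ≡⟨ cong (_+_ p) (*-suc ℓ x) ⟨
  p + ℓ * suc x    ≤⟨ +-monoʳ-≤ p (*-monoʳ-≤ ℓ x<y) ⟩
  p + ℓ * y        ∎
  where open ≤-Reasoning

ℓ*[d∸1]+[1+ℓ]≡ℓ*d+1 : ∀ ℓ {d} → 1 ≤ d → ℓ * (d ∸ 1) + suc ℓ ≡ ℓ * d + 1
ℓ*[d∸1]+[1+ℓ]≡ℓ*d+1 ℓ {suc d} _ = lemma ℓ d
  where
  lemma : ∀ ℓ d → ℓ * d + suc ℓ ≡ ℓ * suc d + 1
  lemma = ℕ-Solver.solve-∀

first-true : ∀ (p : ℕ → Bool) {m} → T (p m) → ∃[ b ] (b ≤ m × T (p b) × (∀ {c} → c < b → ¬ T (p c)))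
first-true p {m} pm with T? (p 0)
... | yes p0 = 0 , z≤n , p0 , λ ()
first-true p {zero}  pm | no ¬p0 = ⊥-elim (¬p0 pm)
first-true p {suc m} pm | no ¬p0 with first-true (p ∘ suc) pm
... | b , b≤m , pb , below = suc b , s≤s b≤m , pb , λ { {zero} _ → ¬p0 ; {suc c} (s≤s c<b) → below c<b }

-- Polynomials in t and power series in x

·ₚ-comm : ∀ p q k → (p ·ₚ q) k ≡ (q ·ₚ p) k
·ₚ-comm p q k = trans (sum≤-reflect k (λ i j → p i * q j)) (sum≤-cong k (λ {i} _ → *-comm (p (k ∸ i)) (q i)))

·ₚ-congʳ : ∀ p {q r} k → (∀ {i} → i ≤ k → q i ≡ r i) → (p ·ₚ q) k ≡ (p ·ₚ r) k
·ₚ-congʳ p k q≗r = sum≤-cong k (λ {i} _ → cong (p i *_) (q≗r (m∸n≤m k i)))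

·ₚ-zeroˡ : ∀ {p} q k → (∀ {i} → i ≤ k → p i ≡ 0) → (p ·ₚ q) k ≡ 0
·ₚ-zeroˡ q k p≗0 = sum≤-zero k (λ i≤k → cong (_* q _) (p≗0 i≤k))

·ₚ-zeroʳ : ∀ p {q} k → (∀ {i} → i ≤ k → q i ≡ 0) → (p ·ₚ q) k ≡ 0
·ₚ-zeroʳ p {q} k q≗0 = trans (·ₚ-comm p q k) (·ₚ-zeroˡ p k q≗0)

oneₚ-pos : ∀ {m} → 0 < m → oneₚ m ≡ 0
oneₚ-pos {suc m} _ = refl

·ₚ-identityʳ : ∀ p k → (p ·ₚ oneₚ) k ≡ p k
·ₚ-identityʳ p k = begin
  (p ·ₚ oneₚ) k         ≡⟨ sum≤-single k k ≤-refl (λ {i} i≤k i≢k →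
                            trans (cong (p i *_) (oneₚ-pos (m<n⇒0<n∸m (≤∧≢⇒< i≤k i≢k)))) (*-zeroʳ (p i))) ⟩
  p k * oneₚ (k ∸ k)    ≡⟨ cong (λ m → p k * oneₚ m) (n∸n≡0 k) ⟩
  p k * 1               ≡⟨ *-identityʳ (p k) ⟩
  p k                   ∎
  where open ≡-Reasoning

monomial : ℕ → Poly
monomial a i = 𝟙 (a ≡ᵇ i)

monomial-≡ : ∀ {a i} → a ≡ i → monomial a i ≡ 1
monomial-≡ {a} a≡i = 𝟙-T (≡⇒≡ᵇ a _ a≡i)

monomial-≢ : ∀ {a i} → a ≢ i → monomial a i ≡ 0
monomial-≢ {a} {i} a≢i = 𝟙-¬T (a≢i ∘ ≡ᵇ⇒≡ a i)

monomial-·ₚ : ∀ a b k → (monomial a ·ₚ monomial b) k ≡ monomial (a + b) k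
monomial-·ₚ a b k with a ≤? k
... | yes a≤k = begin
  (monomial a ·ₚ monomial b) k       ≡⟨ sum≤-single k a a≤k (λ {i} _ i≢a → cong (_* _) (monomial-≢ {a} {i} (i≢a ∘ sym))) ⟩
  monomial a a * monomial b (k ∸ a)  ≡⟨ cong (_* monomial b (k ∸ a)) (monomial-≡ {a} refl) ⟩
  monomial b (k ∸ a) + 0             ≡⟨ +-identityʳ _ ⟩
  monomial b (k ∸ a)                 ≡⟨ shift ⟩
  monomial (a + b) k                 ∎
  where
  open ≡-Reasoning
  shift : monomial b (k ∸ a) ≡ monomial (a + b) k
  shift with b ≟ k ∸ a
  ... | yes b≡k∸a = trans (monomial-≡ b≡k∸a) (sym (monomial-≡ (trans (cong (_+_ a) b≡k∸a) (m+[n∸m]≡n a≤k))))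
  ... | no  b≢k∸a = trans (monomial-≢ b≢k∸a)
                          (sym (monomial-≢ λ a+b≡k → b≢k∸a (trans (sym (m+n∸m≡n a b)) (cong (_∸ a) a+b≡k))))
... | no a≰k = trans (sum≤-zero k (λ {i} i≤k → cong (_* _) (monomial-≢ {a} {i} λ { refl → a≰k i≤k })))
                     (sym (monomial-≢ λ a+b≡k → a≰k (subst (a ≤_) a+b≡k (m≤m+n a b))))

monomial-zero : ∀ k → monomial 0 k ≡ oneₚ k
monomial-zero zero    = refl
monomial-zero (suc k) = refl

-- Product of power series in x with coefficients in ℕ[t]; _*ˢ_ is its analogue over ℤ.
_⋆_ : (ℕ → Poly) → (ℕ → Poly) → ℕ → Poly
(f ⋆ g) n k = sum≤ n (λ j → (f j ·ₚ g (n ∸ j)) k)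

⋆-comm : ∀ f g n k → (f ⋆ g) n k ≡ (g ⋆ f) n k
⋆-comm f g n k = trans (sum≤-reflect n (λ i j → (f i ·ₚ g j) k))
                       (sum≤-cong n (λ {j} _ → ·ₚ-comm (f (n ∸ j)) (g j) k))

one⋆ : ℕ → Poly
one⋆ zero    = oneₚ
one⋆ (suc _) = λ _ → 0

⋆-identityʳ : ∀ f n k → (f ⋆ one⋆) n k ≡ f n k
⋆-identityʳ f n k = begin
  (f ⋆ one⋆) n k                ≡⟨ sum≤-single n n ≤-refl (λ {j} j≤n j≢n →
                                      ·ₚ-zeroʳ (f j) k (λ {i} _ → one⋆-pos {i = i} (m<n⇒0<n∸m (≤∧≢⇒< j≤n j≢n)))) ⟩
  (f n ·ₚ one⋆ (n ∸ n)) k       ≡⟨ cong (λ m → (f n ·ₚ one⋆ m) k) (n∸n≡0 n) ⟩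
  (f n ·ₚ oneₚ) k               ≡⟨ ·ₚ-identityʳ (f n) k ⟩
  f n k                         ∎
  where
  open ≡-Reasoning
  one⋆-pos : ∀ {m i} → 0 < m → one⋆ m i ≡ 0
  one⋆-pos {suc m} _ = refl

embed : (ℕ → Poly) → Series
embed f n k = + f n k

sumℤ≤-cong : ∀ n {f g : ℕ → ℤ} → (∀ i → f i ≡ g i) → sumℤ≤ n f ≡ sumℤ≤ n g
sumℤ≤-cong zero    f≗g = f≗g 0
sumℤ≤-cong (suc n) f≗g = cong₂ _+ℤ_ (sumℤ≤-cong n f≗g) (f≗g (suc n))

sumℤ≤-pos : ∀ n (f : ℕ → ℕ) → sumℤ≤ n (λ i → + f i) ≡ + sum≤ n f
sumℤ≤-pos zero    f = refl
sumℤ≤-pos (suc n) f = trans (cong (_+ℤ + f (suc n)) (sumℤ≤-pos n f)) (sym (pos-+ (sum≤ n f) (f (suc n))))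

sumℤ≤-- : ∀ n (f g : ℕ → ℤ) → sumℤ≤ n (λ i → f i -ℤ g i) ≡ sumℤ≤ n f -ℤ sumℤ≤ n g
sumℤ≤-- zero    f g = refl
sumℤ≤-- (suc n) f g = trans (cong (_+ℤ (f (suc n) -ℤ g (suc n))) (sumℤ≤-- n f g))
                            (interchange (sumℤ≤ n f) (sumℤ≤ n g) (f (suc n)) (g (suc n)))
  where
  interchange : ∀ a b c d → (a -ℤ b) +ℤ (c -ℤ d) ≡ (a +ℤ c) -ℤ (b +ℤ d)
  interchange = solve-∀

*ˢ-congʳ : ∀ f {g h} → (∀ n k → g n k ≡ h n k) → ∀ n k → (f *ˢ g) n k ≡ (f *ˢ h) n k
*ˢ-congʳ f g≗h n k = sumℤ≤-cong n (λ a → sumℤ≤-cong k (λ b → cong (f a b *ℤ_) (g≗h (n ∸ a) (k ∸ b))))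

*ˢ-distribˡ--ˢ : ∀ f g h n k → (f *ˢ (g -ˢ h)) n k ≡ (f *ˢ g) n k -ℤ (f *ˢ h) n k
*ˢ-distribˡ--ˢ f g h n k = begin
  (f *ˢ (g -ˢ h)) n k
    ≡⟨ sumℤ≤-cong n (λ a → sumℤ≤-cong k (λ b → distrib (f a b) _ _)) ⟩
  sumℤ≤ n (λ a → sumℤ≤ k (λ b → f a b *ℤ g (n ∸ a) (k ∸ b) -ℤ f a b *ℤ h (n ∸ a) (k ∸ b)))
    ≡⟨ sumℤ≤-cong n (λ a → sumℤ≤-- k _ _) ⟩
  sumℤ≤ n (λ a → sumℤ≤ k (λ b → f a b *ℤ g (n ∸ a) (k ∸ b))
               -ℤ sumℤ≤ k (λ b → f a b *ℤ h (n ∸ a) (k ∸ b)))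
    ≡⟨ sumℤ≤-- n _ _ ⟩
  (f *ˢ g) n k -ℤ (f *ˢ h) n k
    ∎
  where
  open ≡-Reasoning
  distrib : ∀ a b c → a *ℤ (b -ℤ c) ≡ a *ℤ b -ℤ a *ℤ c
  distrib = solve-∀

embed-*ˢ : ∀ f g n k → (embed f *ˢ embed g) n k ≡ + (f ⋆ g) n k
embed-*ˢ f g n k =
  trans (sumℤ≤-cong n (λ j → trans (sumℤ≤-cong k (λ i → sym (pos-* (f j i) _))) (sumℤ≤-pos k _)))
        (sumℤ≤-pos n _)

oneˢ≡embed-one⋆ : ∀ n k → oneˢ n k ≡ embed one⋆ n k
oneˢ≡embed-one⋆ zero    zero    = refl
oneˢ≡embed-one⋆ zero    (suc k) = refl
oneˢ≡embed-one⋆ (suc n) k       = refl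

*ˢ-inverse : ∀ (f b : ℕ → Poly) → (∀ k → f 0 k ≡ oneₚ k) → (∀ k → b 0 k ≡ 0) →
             (∀ n → 1 ≤ n → ∀ k → f n k ≡ (b ⋆ f) n k) →
             ∀ n k → (embed f *ˢ (oneˢ -ˢ embed b)) n k ≡ oneˢ n k
*ˢ-inverse f b f₀ b₀ f≡b⋆f n k = begin
  (embed f *ˢ (oneˢ -ˢ embed b)) n k
    ≡⟨ *ˢ-distribˡ--ˢ (embed f) oneˢ (embed b) n k ⟩
  (embed f *ˢ oneˢ) n k -ℤ (embed f *ˢ embed b) n k
    ≡⟨ cong₂ _-ℤ_ (trans (*ˢ-congʳ (embed f) oneˢ≡embed-one⋆ n k) (embed-*ˢ f one⋆ n k)) (embed-*ˢ f b n k) ⟩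
  + (f ⋆ one⋆) n k -ℤ + (f ⋆ b) n k
    ≡⟨ cong₂ (λ x y → + x -ℤ + y) (⋆-identityʳ f n k) (⋆-comm f b n k) ⟩
  + f n k -ℤ + (b ⋆ f) n k
    ≡⟨ constant-term n ⟩
  oneˢ n k
    ∎
  where
  open ≡-Reasoning
  constant-term : ∀ n → + f n k -ℤ + (b ⋆ f) n k ≡ oneˢ n k
  constant-term zero    = trans (cong₂ (λ x y → + x -ℤ + y) (f₀ k) (·ₚ-zeroˡ (f 0) k (λ {i} _ → b₀ i))) (one k)
    where
    one : ∀ k → + oneₚ k -ℤ + 0 ≡ oneˢ 0 k
    one zero    = refl
    one (suc k) = refl
  constant-term (suc n) = trans (cong (λ x → + f (suc n) k -ℤ + x) (sym (f≡b⋆f (suc n) (s≤s z≤n) k)))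
                                (+-inverseʳ (+ f (suc n) k))

⋆≡sum1to-shift : ∀ (b f : ℕ → Poly) L n k → (∀ i → b 0 i ≡ 0) → (∀ {j} → L < j → ∀ i → b j i ≡ 0) →
                 (b ⋆ f) n k ≡ sum1to L (λ j → b j ·ₚ (λ i → if j ≤ᵇ n then f (n ∸ j) i else 0)) k
⋆≡sum1to-shift b f L n k b₀ b-vanishes = begin
  (b ⋆ f) n k
    ≡⟨ sum≤-cong n (λ {j} j≤n → ·ₚ-congʳ (b j) {f (n ∸ j)} {shift j} k (λ _ → sym (if-T (≤⇒≤ᵇ j≤n)))) ⟩
  sum≤ n G
    ≡⟨ sum≤-+-vanishing n L (λ {j} n<j → ·ₚ-zeroʳ (b j) {shift j} k (λ _ → if-¬T (<⇒≱ n<j ∘ ≤ᵇ⇒≤ j n))) ⟨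
  sum≤ (n + L) G
    ≡⟨ cong (λ m → sum≤ m G) (+-comm n L) ⟩
  sum≤ (L + n) G
    ≡⟨ sum≤-+-vanishing L n (λ {j} L<j → ·ₚ-zeroˡ (shift j) k (λ {i} _ → b-vanishes L<j i)) ⟩
  sum≤ L G
    ≡⟨ sum≤≡head+sum1to L (λ j → b j ·ₚ shift j) k ⟩
  G 0 + sum1to L (λ j → b j ·ₚ shift j) k
    ≡⟨ cong (_+ sum1to L (λ j → b j ·ₚ shift j) k) (·ₚ-zeroˡ (shift 0) k (λ {i} _ → b₀ i)) ⟩
  sum1to L (λ j → b j ·ₚ shift j) k
    ∎
  where
  open ≡-Reasoning
  shift : ℕ → Poly
  shift j i = if j ≤ᵇ n then f (n ∸ j) i else 0
  G : ℕ → ℕ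
  G j = (b j ·ₚ shift j) k

-- Words over {1, …, d, ∞}

LetterIn : ℕ → Letter → Set
LetterIn d ∞       = ⊤
LetterIn d (fin v) = 1 ≤ v × v ≤ d

alphabet-letters : ∀ d → All (LetterIn d) (alphabet d)
alphabet-letters d = tt ∷ applyUpTo⁺₁ _ d (λ i<d → s≤s z≤n , i<d)

words-wellFormed : ∀ d n → All (λ w → length w ≡ n × All (LetterIn d) w) (words d n)
words-wellFormed d zero    = (refl , []) ∷ []
words-wellFormed d (suc n) =
  concat⁺ (map⁺ (All.map (λ a∈ → map⁺ (All.map (λ (len , w∈) → cong suc len , a∈ ∷ w∈) (words-wellFormed d n)))
                         (alphabet-letters d)))

count : ℕ → ℕ → (List Letter → ℕ) → ℕ
count d n f = sum (map f (words d n))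

count-cong : ∀ d n {f g : List Letter → ℕ} → (∀ {w} → length w ≡ n → All (LetterIn d) w → f w ≡ g w) →
             count d n f ≡ count d n g
count-cong d n f≗g = cong sum (map-cong-local (All.map (λ (len , w∈) → f≗g len w∈) (words-wellFormed d n)))

count-suc : ∀ d n f → count d (suc n) f ≡ sum (map (λ a → count d n (f ∘ (a ∷_))) (alphabet d))
count-suc d n f = trans (sum-map-concatMap f (λ a → map (a ∷_) (words d n)) (alphabet d))
                        (cong sum (map-cong (λ a → cong sum (sym (map-∘ (words d n)))) (alphabet d)))

count-take-drop : ∀ d j m f g → count d (j + m) (λ w → f (take j w) * g (drop j w)) ≡ count d j f * count d m g
count-take-drop d zero    m f g = trans (sum-map-*ˡ (f []) g (words d m)) (cong (_* count d m g) (sym (+-identityʳ (f []))))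
count-take-drop d (suc j) m f g = begin
  count d (suc (j + m)) (λ w → f (take (suc j) w) * g (drop (suc j) w))
    ≡⟨ count-suc d (j + m) _ ⟩
  sum (map (λ a → count d (j + m) (λ w → f (a ∷ take j w) * g (drop j w))) (alphabet d))
    ≡⟨ cong sum (map-cong (λ a → count-take-drop d j m (f ∘ (a ∷_)) g) (alphabet d)) ⟩
  sum (map (λ a → count d j (f ∘ (a ∷_)) * count d m g) (alphabet d))
    ≡⟨ sum-map-*ʳ (count d m g) (λ a → count d j (f ∘ (a ∷_))) (alphabet d) ⟩
  sum (map (λ a → count d j (f ∘ (a ∷_))) (alphabet d)) * count d m g
    ≡⟨ cong (_* count d m g) (count-suc d j f) ⟨
  count d (suc j) f * count d m g
    ∎
  where open ≡-Reasoning

!!-take : ∀ {j} w {x} → x < j → take j w !! x ≡ w !! x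
!!-take {suc j} []      _          = refl
!!-take {suc j} (a ∷ w) {zero}  _  = refl
!!-take {suc j} (a ∷ w) {suc x} (s≤s x<j) = !!-take w x<j

!!-take-≥ : ∀ {j} w {x} → j ≤ x → take j w !! x ≡ nothing
!!-take-≥ {zero}  w       _         = refl
!!-take-≥ {suc j} []      _         = refl
!!-take-≥ {suc j} (a ∷ w) (s≤s j≤x) = !!-take-≥ w j≤x

!!-take-just : ∀ {j} w {x a} → take j w !! x ≡ just a → w !! x ≡ just a × x < j
!!-take-just {j} w {x} e with x <? j
... | yes x<j = trans (sym (!!-take w x<j)) e , x<j
... | no  x≮j with () ← trans (sym (!!-take-≥ w (≮⇒≥ x≮j))) e

!!-take-mono : ∀ {j j′} w {x a} → j ≤ j′ → take j w !! x ≡ just a → take j′ w !! x ≡ just a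
!!-take-mono w j≤j′ e = let w!!x≡a , x<j = !!-take-just w e in trans (!!-take w (<-≤-trans x<j j≤j′)) w!!x≡a

!!-drop : ∀ j w x → drop j w !! x ≡ w !! (j + x)
!!-drop zero    w       x = refl
!!-drop (suc j) []      x = refl
!!-drop (suc j) (a ∷ w) x = !!-drop j w x

!!-≥ : ∀ w {x} → length w ≤ x → w !! x ≡ nothing
!!-≥ []      _         = refl
!!-≥ (a ∷ w) (s≤s n≤x) = !!-≥ w n≤x

!!-just⇒< : ∀ w {x a} → w !! x ≡ just a → x < length w
!!-just⇒< (b ∷ w) {zero}  _ = s≤s z≤n
!!-just⇒< (b ∷ w) {suc x} e = s≤s (!!-just⇒< w e)

!!-All : ∀ {P : Letter → Set} {w x a} → All P w → w !! x ≡ just a → P a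
!!-All {x = zero}  (pa ∷ _)  refl = pa
!!-All {x = suc x} (_  ∷ pw) e    = !!-All pw e

length-take-≤ : ∀ {j} (w : List Letter) → j ≤ length w → length (take j w) ≡ j
length-take-≤ {j} w j≤n = trans (length-take j w) (m≤n⇒m⊓n≡m j≤n)

bigtiles-take-drop : ∀ j w → bigtiles (take j w) + bigtiles (drop j w) ≡ bigtiles w
bigtiles-take-drop zero    w           = refl
bigtiles-take-drop (suc j) []          = refl
bigtiles-take-drop (suc j) (∞ ∷ w)     = bigtiles-take-drop j w
bigtiles-take-drop (suc j) (fin _ ∷ w) = cong suc (bigtiles-take-drop j w)

-- Anchor words

module AnchorWords (ℓ : ℕ) (μ : Vec ℕ (suc ℓ)) where

  Block : List Letter → ℕ → Set
  Block w j = ∀ {t} → t < ℓ → w !! (j + t) ≡ just ∞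

  Trailing : List Letter → Set
  Trailing w = ∀ {x} → x < length w → length w ∸ ℓ ≤ x → w !! x ≡ just ∞

  AnchoredAt : List Letter → ℕ → Set
  AnchoredAt w i = ∀ {v} → w !! i ≡ just (fin v) → (k : Fin ℓ) →
                   ∃[ b ] (w !! (i + suc (toℕ k)) ≡ just b × T (geqL b (v + lookup μ (F.suc k))))

  record Anchor (w : List Letter) : Set where
    field
      anchored : ∀ i → AnchoredAt w i
      trailing : Trailing w

  record FaultFreeFin (w : List Letter) : Set where
    field
      first : ∃[ v ] (w !! 0 ≡ just (fin v))
      long  : ℓ ≤ length w
      final : Block w (length w ∸ ℓ)
      only  : ∀ {j} → j < length w → Block w j → j ≡ length w ∸ ℓ

  FaultFree : List Letter → Set
  FaultFree w = w ≡ ∞ ∷ [] ⊎ FaultFreeFin w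

  condAt⇒AnchoredAt : ∀ w i → T (condAt ℓ μ w i) → AnchoredAt w i
  condAt⇒AnchoredAt w i h {v} e k rewrite e with tabulate⁻ (all⇒All _ (allFin ℓ) h) k
  ... | hk with w !! (i + suc (toℕ k))
  ...   | just b = b , refl , hk

  AnchoredAt⇒condAt : ∀ w i → AnchoredAt w i → T (condAt ℓ μ w i)
  AnchoredAt⇒condAt w i c with T? (condAt ℓ μ w i)
  ... | yes h = h
  ... | no ¬h with w !! i
  ...   | nothing = ⊥-elim (¬h tt)
  ...   | just ∞  = ⊥-elim (¬h tt)
  ...   | just (fin v) with Any.tabulate⁻ (¬all⇒Any¬ _ (allFin ℓ) ¬h)
  ...     | k , ¬hk with c refl k
  ...       | b , eb , g with w !! (i + suc (toℕ k))
  ...         | just _ with refl ← eb = ⊥-elim (¬hk g)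

  trailingInf⇒Trailing : ∀ w → T (trailingInf ℓ w) → Trailing w
  trailingInf⇒Trailing w h {x} x<n n∸ℓ≤x with applyUpTo⁻ _ (length w) (all⇒All _ (upTo (length w)) h) x<n
  ... | hx with length w ∸ ℓ ≤ᵇ x | ≤⇒≤ᵇ n∸ℓ≤x
  ...   | true | _ with w !! x
  ...     | just ∞ = refl

  Trailing⇒trailingInf : ∀ w → Trailing w → T (trailingInf ℓ w)
  Trailing⇒trailingInf w tr with T? (trailingInf ℓ w)
  ... | yes h = h
  ... | no ¬h with Any.applyUpTo⁻ _ (¬all⇒Any¬ _ (upTo (length w)) ¬h)
  ...   | x , x<n , ¬hx with length w ∸ ℓ ≤ᵇ x in le
  ...     | false = ⊥-elim (¬hx tt)
  ...     | true with w !! x | tr x<n (≤ᵇ⇒≤ _ _ (from T-≡ le))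
  ...       | just ∞ | _ = ⊥-elim (¬hx tt)

  infBlock⇒Block : ∀ w j → T (infBlock ℓ w j) → Block w j
  infBlock⇒Block w j h {t} t<ℓ with applyUpTo⁻ _ ℓ (all⇒All _ (upTo ℓ) h) t<ℓ
  ... | ht with w !! (j + t)
  ...   | just ∞ = refl

  ¬infBlock⇒gap : ∀ w j → ¬ T (infBlock ℓ w j) → ∃[ t ] (t < ℓ × w !! (j + t) ≢ just ∞)
  ¬infBlock⇒gap w j ¬h with Any.applyUpTo⁻ _ (¬all⇒Any¬ _ (upTo ℓ) ¬h)
  ... | t , t<ℓ , ¬ht = t , t<ℓ , gap
    where
    gap : w !! (j + t) ≢ just ∞
    gap e with w !! (j + t)
    gap refl | just ∞ = ¬ht tt

  Block⇒infBlock : ∀ w j → Block w j → T (infBlock ℓ w j)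
  Block⇒infBlock w j bl with T? (infBlock ℓ w j)
  ... | yes h = h
  ... | no ¬h with ¬infBlock⇒gap w j ¬h
  ...   | t , t<ℓ , gap = ⊥-elim (gap (bl t<ℓ))

  block-or-gap : ∀ w j → Block w j ⊎ ∃[ t ] (t < ℓ × w !! (j + t) ≢ just ∞)
  block-or-gap w j with T? (infBlock ℓ w j)
  ... | yes h = inj₁ (infBlock⇒Block w j h)
  ... | no ¬h = inj₂ (¬infBlock⇒gap w j ¬h)

  AnchoredAt-∞ : ∀ w i → w !! i ≡ just ∞ → AnchoredAt w i
  AnchoredAt-∞ w i w!!i≡∞ w!!i≡v with () ← trans (sym w!!i≡∞) w!!i≡v

  AnchoredAt-≥ : ∀ w {i} → length w ≤ i → AnchoredAt w i
  AnchoredAt-≥ w n≤i w!!i≡v with () ← trans (sym (!!-≥ w n≤i)) w!!i≡v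

  isAnchor⇒Anchor : ∀ w → T (isAnchor ℓ μ w) → Anchor w
  isAnchor⇒Anchor w h = record { anchored = anchored ; trailing = trailingInf⇒Trailing w (proj₂ (to T-∧ h)) }
    where
    anchored : ∀ i → AnchoredAt w i
    anchored i with i <? length w
    ... | yes i<n = condAt⇒AnchoredAt w i (applyUpTo⁻ _ (length w) (all⇒All _ (upTo (length w)) (proj₁ (to T-∧ h))) i<n)
    ... | no  i≮n = AnchoredAt-≥ w (≮⇒≥ i≮n)

  Anchor⇒isAnchor : ∀ w → Anchor w → T (isAnchor ℓ μ w)
  Anchor⇒isAnchor w a = from T-∧ ( All⇒all _ (applyUpTo⁺₁ _ (length w) (λ {i} _ → AnchoredAt⇒condAt w i (anchored i)))
                                  , Trailing⇒trailingInf w trailing )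
    where open Anchor a

  finalBlockOnly : List Letter → Bool
  finalBlockOnly w = all (λ j → not (infBlock ℓ w j) ∨ (j ≡ᵇ (length w ∸ ℓ))) (upTo (length w))

  finalBlockOnly⇒ : ∀ w → T (finalBlockOnly w) → ∀ {j} → j < length w → Block w j → j ≡ length w ∸ ℓ
  finalBlockOnly⇒ w h {j} j<n bj with applyUpTo⁻ _ (length w) (all⇒All _ (upTo (length w)) h) j<n
  ... | hj with infBlock ℓ w j | Block⇒infBlock w j bj
  ...   | true | _ = ≡ᵇ⇒≡ j (length w ∸ ℓ) hj

  ⇒finalBlockOnly : ∀ w → (∀ {j} → j < length w → Block w j → j ≡ length w ∸ ℓ) → T (finalBlockOnly w)
  ⇒finalBlockOnly w only = All⇒all _ (applyUpTo⁺₁ _ (length w) onlyᵇ)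
    where
    onlyᵇ : ∀ {j} → j < length w → T (not (infBlock ℓ w j) ∨ (j ≡ᵇ (length w ∸ ℓ)))
    onlyᵇ {j} j<n with infBlock ℓ w j in eq
    ... | false = tt
    ... | true  = ≡⇒≡ᵇ j _ (only j<n (infBlock⇒Block w j (from T-≡ eq)))

  isFaultFree⇒FaultFree : ∀ w → T (isFaultFree ℓ w) → FaultFree w
  isFaultFree⇒FaultFree w h with to T-∨ h
  ... | inj₁ single = inj₁ (singleton w single)
    where
    singleton : ∀ w → T (isSingleInf w) → w ≡ ∞ ∷ []
    singleton (∞ ∷ []) _ = refl
  ... | inj₂ rest = inj₂ (faultFreeFin rest)
    where
    first : ∀ w → T (startsFin w) → ∃[ v ] (w !! 0 ≡ just (fin v))
    first (fin v ∷ _) _ = v , refl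
    faultFreeFin : T (startsFin w ∧ (ℓ ≤ᵇ length w) ∧ infBlock ℓ w (length w ∸ ℓ) ∧ finalBlockOnly w) →
                   FaultFreeFin w
    faultFreeFin h =
      let starts , h′ = to T-∧ h
          long , h″   = to T-∧ h′
          final , only = to T-∧ h″
      in record { first = first w starts ; long = ≤ᵇ⇒≤ ℓ (length w) long
                ; final = infBlock⇒Block w _ final ; only = finalBlockOnly⇒ w only }

  FaultFree⇒isFaultFree : ∀ w → FaultFree w → T (isFaultFree ℓ w)
  FaultFree⇒isFaultFree _ (inj₁ refl) = tt
  FaultFree⇒isFaultFree w (inj₂ ff) =
    from T-∨ (inj₂ (from T-∧ (starts w first , from T-∧ (≤⇒≤ᵇ long , from T-∧ (Block⇒infBlock w _ final
             , ⇒finalBlockOnly w only)))))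
    where
    open FaultFreeFin ff
    starts : ∀ w → ∃[ v ] (w !! 0 ≡ just (fin v)) → T (startsFin w)
    starts (fin _ ∷ _) _ = tt

  AnchoredAt-transfer : ∀ w i w′ i′ → (∀ {t} → t ≤ ℓ → w !! (i + t) ≡ w′ !! (i′ + t)) →
                        AnchoredAt w i → AnchoredAt w′ i′
  AnchoredAt-transfer w i w′ i′ same a e k with a (trans here e) k
    where
    here : w !! i ≡ w′ !! i′
    here = trans (cong (w !!_) (sym (+-identityʳ i))) (trans (same z≤n) (cong (w′ !!_) (+-identityʳ i′)))
  ... | b , eb , g = b , trans (sym (same (toℕ<n k))) eb , g

  Anchor-drop : ∀ j {w} → Anchor w → Anchor (drop j w)
  Anchor-drop j {w} a = record
    { anchored = λ i → AnchoredAt-transfer w (j + i) (drop j w) i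
                         (λ {t} _ → trans (cong (w !!_) (+-assoc j i t)) (sym (!!-drop j w (i + t))))
                         (anchored (j + i))
    ; trailing = λ {x} x<n p → trans (!!-drop j w x)
                   (trailing (o<n∸m⇒m+o<n j (subst (x <_) (length-drop j w) x<n))
                             (m∸n∸o≤x⇒m∸o≤n+x (length w) j ℓ (subst (λ m → m ∸ ℓ ≤ x) (length-drop j w) p)))
    }
    where open Anchor a

  Anchor-take-trailing : ∀ j {w} → j ≤ length w → Anchor (take j w) →
                         ∀ {x} → x < j → j ∸ ℓ ≤ x → w !! x ≡ just ∞
  Anchor-take-trailing j {w} j≤n au {x} x<j j∸ℓ≤x =
    trans (sym (!!-take w x<j))
          (trailing (subst (x <_) (sym |u|≡j) x<j) (subst (λ m → m ∸ ℓ ≤ x) (sym |u|≡j) j∸ℓ≤x))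
    where
    open Anchor au
    |u|≡j : length (take j w) ≡ j
    |u|≡j = length-take-≤ w j≤n

  Anchor-join : ∀ j {w} → j ≤ length w → Anchor (take j w) → Anchor (drop j w) → Anchor w
  Anchor-join j {w} j≤n au av = record { anchored = anchored ; trailing = trailing }
    where
    module U = Anchor au
    module V = Anchor av
    anchored : ∀ i → AnchoredAt w i
    anchored i with i <? j | j ∸ ℓ ≤? i
    ... | yes i<j | yes j∸ℓ≤i = AnchoredAt-∞ w i (Anchor-take-trailing j j≤n au i<j j∸ℓ≤i)
    ... | yes i<j | no  j∸ℓ≰i = AnchoredAt-transfer (take j w) i w i
          (λ t≤ℓ → !!-take w (≤-<-trans (+-monoʳ-≤ i t≤ℓ)
                                        (subst (_< j) (+-comm ℓ i) (o<n∸m⇒m+o<n ℓ (≰⇒> j∸ℓ≰i)))))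
          (U.anchored i)
    ... | no  i≮j | _ = AnchoredAt-transfer (drop j w) (i ∸ j) w i
          (λ {t} _ → trans (!!-drop j w (i ∸ j + t))
                           (cong (w !!_) (trans (sym (+-assoc j (i ∸ j) t)) (cong (_+ t) (m+[n∸m]≡n (≮⇒≥ i≮j))))))
          (V.anchored (i ∸ j))
    trailing : Trailing w
    trailing {x} x<n n∸ℓ≤x with x <? j
    ... | yes x<j = Anchor-take-trailing j j≤n au x<j (≤-trans (∸-monoˡ-≤ ℓ j≤n) n∸ℓ≤x)
    ... | no  x≮j = begin
      w !! x             ≡⟨ cong (w !!_) (m+[n∸m]≡n j≤x) ⟨
      w !! (j + (x ∸ j)) ≡⟨ !!-drop j w (x ∸ j) ⟨
      drop j w !! (x ∸ j) ≡⟨ V.trailing (subst (x ∸ j <_) (sym (length-drop j w)) (∸-monoˡ-< x<n j≤x))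
                                        (subst (λ m → m ∸ ℓ ≤ x ∸ j) (sym (length-drop j w))
                                               (subst (_≤ x ∸ j) (∸-∸-comm (length w) ℓ j) (∸-monoˡ-≤ j n∸ℓ≤x))) ⟩
      just ∞             ∎
      where
      open ≡-Reasoning
      j≤x : j ≤ x
      j≤x = ≮⇒≥ x≮j

  FaultFreeFin-prefix : 1 ≤ ℓ → ∀ {u u′} → (∀ {x a} → u !! x ≡ just a → u′ !! x ≡ just a) →
                        FaultFreeFin u → FaultFreeFin u′ → length u ≡ length u′
  FaultFreeFin-prefix ℓ≥1 {u} {u′} u⊑u′ ff ff′ = begin
    length u          ≡⟨ m∸n+n≡m U.long ⟨
    length u ∸ ℓ + ℓ  ≡⟨ cong (_+ ℓ) (U′.only b<|u′| block′) ⟩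
    length u′ ∸ ℓ + ℓ ≡⟨ m∸n+n≡m U′.long ⟩
    length u′         ∎
    where
    open ≡-Reasoning
    module U  = FaultFreeFin ff
    module U′ = FaultFreeFin ff′
    block′ : Block u′ (length u ∸ ℓ)
    block′ t<ℓ = u⊑u′ (U.final t<ℓ)
    b<|u′| : length u ∸ ℓ < length u′
    b<|u′| = subst (_< length u′) (+-identityʳ _) (!!-just⇒< u′ (block′ ℓ≥1))

  FaultFree-prefix-unique : 1 ≤ ℓ → ∀ {w j j′} → j ≤ length w → j′ ≤ length w →
                            FaultFree (take j w) → FaultFree (take j′ w) → j ≡ j′
  FaultFree-prefix-unique ℓ≥1 {w} {j} {j′} j≤n j′≤n = unique
    where
    lengths : length (take j w) ≡ length (take j′ w) → j ≡ j′
    lengths eq = trans (sym (length-take-≤ w j≤n)) (trans eq (length-take-≤ w j′≤n))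
    starts-∞-and-fin : ∀ {i i′} → take i w ≡ ∞ ∷ [] → ¬ FaultFreeFin (take i′ w)
    starts-∞-and-fin {i} {i′} u≡∞ ff with FaultFreeFin.first ff
    ... | v , e with () ← trans (sym (proj₁ (!!-take-just {i} w (cong (_!! 0) u≡∞)))) (proj₁ (!!-take-just {i′} w e))
    unique : FaultFree (take j w) → FaultFree (take j′ w) → j ≡ j′
    unique (inj₁ u≡∞) (inj₁ u′≡∞) = lengths (cong length (trans u≡∞ (sym u′≡∞)))
    unique (inj₁ u≡∞) (inj₂ ff′)  = ⊥-elim (starts-∞-and-fin u≡∞ ff′)
    unique (inj₂ ff)  (inj₁ u′≡∞) = ⊥-elim (starts-∞-and-fin u′≡∞ ff)
    unique (inj₂ ff)  (inj₂ ff′) with ≤-total j j′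
    ... | inj₁ j≤j′ = lengths (FaultFreeFin-prefix ℓ≥1 (!!-take-mono w j≤j′) ff ff′)
    ... | inj₂ j′≤j = lengths (sym (FaultFreeFin-prefix ℓ≥1 (!!-take-mono w j′≤j) ff′ ff))

  Anchor-[∞] : Anchor (∞ ∷ [])
  Anchor-[∞] = record { anchored = anchored ; trailing = trailing }
    where
    anchored : ∀ i → AnchoredAt (∞ ∷ []) i
    anchored zero    = AnchoredAt-∞ (∞ ∷ []) 0 refl
    anchored (suc i) = AnchoredAt-≥ (∞ ∷ []) (s≤s (z≤n {i}))
    trailing : Trailing (∞ ∷ [])
    trailing {zero}  _         _ = refl
    trailing {suc x} (s≤s ()) _

  Anchor-fin⇒ℓ< : ∀ {v u} → Anchor (fin v ∷ u) → ℓ < length (fin v ∷ u)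
  Anchor-fin⇒ℓ< {v} {u} a with ℓ <? length (fin v ∷ u)
  ... | yes ℓ<n = ℓ<n
  ... | no  ℓ≮n with () ← Anchor.trailing a (s≤s z≤n) (subst (_≤ 0) (sym (m≤n⇒m∸n≡0 (≮⇒≥ ℓ≮n))) z≤n)

  Anchor-final-block : ∀ {w} → Anchor w → ℓ ≤ length w → Block w (length w ∸ ℓ)
  Anchor-final-block {w} a ℓ≤n {t} t<ℓ =
    Anchor.trailing a (subst (length w ∸ ℓ + t <_) (m∸n+n≡m ℓ≤n) (+-monoʳ-< (length w ∸ ℓ) t<ℓ)) (m≤m+n _ t)

  Block-take : ∀ {w b} → Block w b → ∀ {x} → b ≤ x → x < b + ℓ → take (b + ℓ) w !! x ≡ just ∞
  Block-take {w} {b} block {x} b≤x x<b+ℓ = begin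
    take (b + ℓ) w !! x ≡⟨ !!-take w x<b+ℓ ⟩
    w !! x              ≡⟨ cong (w !!_) (m+[n∸m]≡n b≤x) ⟨
    w !! (b + (x ∸ b))  ≡⟨ block (subst (x ∸ b <_) (m+n∸m≡n b ℓ) (∸-monoˡ-< x<b+ℓ b≤x)) ⟩
    just ∞              ∎
    where open ≡-Reasoning

  Anchor-take-block : ∀ {w b} → Anchor w → Block w b → b + ℓ ≤ length w → Anchor (take (b + ℓ) w)
  Anchor-take-block {w} {b} a block b+ℓ≤n = record
    { anchored = anchored
    ; trailing = λ {x} x<|u| |u|∸ℓ≤x →
        Block-take block (subst (_≤ x) (trans (cong (_∸ ℓ) |u|≡b+ℓ) (m+n∸n≡m b ℓ)) |u|∸ℓ≤x)
                         (subst (x <_) |u|≡b+ℓ x<|u|)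
    }
    where
    |u|≡b+ℓ : length (take (b + ℓ) w) ≡ b + ℓ
    |u|≡b+ℓ = length-take-≤ w b+ℓ≤n
    anchored : ∀ i → AnchoredAt (take (b + ℓ) w) i
    anchored i with i <? b | i <? b + ℓ
    ... | yes i<b | _         = AnchoredAt-transfer w i (take (b + ℓ) w) i
                                  (λ t≤ℓ → sym (!!-take w (+-mono-<-≤ i<b t≤ℓ))) (Anchor.anchored a i)
    ... | no  i≮b | yes i<b+ℓ = AnchoredAt-∞ (take (b + ℓ) w) i (Block-take block (≮⇒≥ i≮b) i<b+ℓ)
    ... | no  _   | no  i≮b+ℓ = AnchoredAt-≥ (take (b + ℓ) w) (subst (_≤ i) (sym |u|≡b+ℓ) (≮⇒≥ i≮b+ℓ))

  FaultFreeFin-take-first-block : 1 ≤ ℓ → ∀ {w b v} → w !! 0 ≡ just (fin v) → Block w b →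
                                  (∀ {c} → c < b → ¬ Block w c) → b + ℓ ≤ length w →
                                  FaultFreeFin (take (b + ℓ) w)
  FaultFreeFin-take-first-block ℓ≥1 {w} {b} {v} first block below b+ℓ≤n = record
    { first = v , trans (!!-take w (≤-trans ℓ≥1 (m≤n+m ℓ b))) first
    ; long  = subst (ℓ ≤_) (sym |u|≡b+ℓ) (m≤n+m ℓ b)
    ; final = λ {t} t<ℓ → subst (λ y → take (b + ℓ) w !! (y + t) ≡ just ∞) (sym |u|∸ℓ≡b)
                                (Block-take block (m≤m+n b t) (+-monoʳ-< b t<ℓ))
    ; only  = λ _ block-c → trans (≤-antisym (c≤b block-c) (b≤c block-c)) (sym |u|∸ℓ≡b)
    }
    where
    |u|≡b+ℓ : length (take (b + ℓ) w) ≡ b + ℓ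
    |u|≡b+ℓ = length-take-≤ w b+ℓ≤n
    |u|∸ℓ≡b : length (take (b + ℓ) w) ∸ ℓ ≡ b
    |u|∸ℓ≡b = trans (cong (_∸ ℓ) |u|≡b+ℓ) (m+n∸n≡m b ℓ)
    b≤c : ∀ {c} → Block (take (b + ℓ) w) c → b ≤ c
    b≤c {c} block-c with c <? b
    ... | yes c<b = ⊥-elim (below c<b (λ t<ℓ → proj₁ (!!-take-just {b + ℓ} w (block-c t<ℓ))))
    ... | no  c≮b = ≮⇒≥ c≮b
    c≤b : ∀ {c} → Block (take (b + ℓ) w) c → c ≤ b
    c≤b block-c = m+[ℓ∸1]<n+ℓ⇒m≤n ℓ≥1 (proj₂ (!!-take-just {b + ℓ} w (block-c (n∸1<n ℓ≥1))))

  FaultFree-prefix-exists : 1 ≤ ℓ → ∀ {w} → Anchor w → 1 ≤ length w →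
                            ∃[ j ] (j ≤ length w × Anchor (take j w) × FaultFree (take j w))
  FaultFree-prefix-exists ℓ≥1 {∞ ∷ _} _ _ = 1 , s≤s z≤n , Anchor-[∞] , inj₁ refl
  FaultFree-prefix-exists ℓ≥1 {w@(fin v ∷ _)} a _
    with first-true (infBlock ℓ w) (Block⇒infBlock w (length w ∸ ℓ) (Anchor-final-block a (<⇒≤ (Anchor-fin⇒ℓ< a))))
  ... | b , b≤n∸ℓ , block-b , below =
    b + ℓ , b+ℓ≤n , Anchor-take-block a block (b+ℓ≤n)
          , inj₂ (FaultFreeFin-take-first-block ℓ≥1 refl block (λ {c} c<b → below c<b ∘ Block⇒infBlock w c) b+ℓ≤n)
    where
    block : Block w b
    block = infBlock⇒Block w b block-b
    b+ℓ≤n : b + ℓ ≤ length w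
    b+ℓ≤n = subst (b + ℓ ≤_) (m∸n+n≡m (<⇒≤ (Anchor-fin⇒ℓ< a))) (+-monoˡ-≤ ℓ b≤n∸ℓ)

  FaultFreeFin-length-from : 1 ≤ ℓ → (∀ k → 1 ≤ lookup μ (F.suc k)) → ∀ {d w} →
                             Anchor w → FaultFreeFin w → All (LetterIn d) w →
                             ∀ {p v} → w !! p ≡ just (fin v) → length w ≤ p + ℓ * (d ∸ v) + suc ℓ
  FaultFreeFin-length-from ℓ≥1 μ⁺ {d} {w} a ff letters {v = v} = go (<-wellFounded (d ∸ v))
    where
    open Anchor a
    open FaultFreeFin ff
    go : ∀ {p v} → Acc _<_ (d ∸ v) → w !! p ≡ just (fin v) → length w ≤ p + ℓ * (d ∸ v) + suc ℓ
    go {p} {v} _ e with block-or-gap w (suc p)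
    ... | inj₁ block = begin
      length w                ≡⟨ m∸n+n≡m long ⟨
      length w ∸ ℓ + ℓ        ≡⟨ cong (_+ ℓ) (only p+1<n block) ⟨
      suc p + ℓ               ≡⟨ +-suc p ℓ ⟨
      p + suc ℓ               ≤⟨ +-monoˡ-≤ (suc ℓ) (m≤m+n p _) ⟩
      p + ℓ * (d ∸ v) + suc ℓ ∎
      where
      open ≤-Reasoning
      p+1<n : suc p < length w
      p+1<n = subst (_< length w) (+-identityʳ (suc p)) (!!-just⇒< w (block ℓ≥1))
    go {p} {v} (acc smaller) e | inj₂ (t , t<ℓ , gap) with anchored p e (F.fromℕ< t<ℓ)
    ... | b , e-b , v+μ≤b with b | trans (cong (λ s → w !! (p + suc s)) (sym (toℕ-fromℕ< t<ℓ))) e-b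
    ...   | ∞      | e∞   = ⊥-elim (gap (trans (cong (w !!_) (sym (+-suc p t))) e∞))
    ...   | fin v₂ | next =
      ≤-trans (go (smaller d∸v₂<d∸v) next) (+-monoˡ-≤ (suc ℓ) (p+s+ℓ*x≤p+ℓ*y ℓ p t<ℓ d∸v₂<d∸v))
      where
      v<v₂ : v < v₂
      v<v₂ = <-≤-trans (m<m+n v (μ⁺ (F.fromℕ< t<ℓ))) (≤ᵇ⇒≤ _ v₂ v+μ≤b)
      d∸v₂<d∸v : d ∸ v₂ < d ∸ v
      d∸v₂<d∸v = ∸-monoʳ-< v<v₂ (proj₂ (!!-All letters next))

  FaultFree-length : 1 ≤ ℓ → (∀ k → 1 ≤ lookup μ (F.suc k)) → ∀ {d w} →
                     Anchor w → FaultFree w → All (LetterIn d) w → length w ≤ ℓ * d + 1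
  FaultFree-length ℓ≥1 μ⁺ {d} _ (inj₁ refl) _ = m≤n+m 1 (ℓ * d)
  FaultFree-length ℓ≥1 μ⁺ {d} {w} a (inj₂ ff) letters with FaultFreeFin.first ff
  ... | v , e with !!-All letters e
  ...   | 1≤v , v≤d = begin
    length w                ≤⟨ FaultFreeFin-length-from ℓ≥1 μ⁺ a ff letters e ⟩
    ℓ * (d ∸ v) + suc ℓ     ≤⟨ +-monoˡ-≤ (suc ℓ) (*-monoʳ-≤ ℓ (∸-monoʳ-≤ d 1≤v)) ⟩
    ℓ * (d ∸ 1) + suc ℓ     ≡⟨ ℓ*[d∸1]+[1+ℓ]≡ℓ*d+1 ℓ (≤-trans 1≤v v≤d) ⟩
    ℓ * d + 1               ∎
    where open ≤-Reasoning

IsPartition⇒positive : ∀ ℓ μ → IsPartition ℓ μ → ∀ i → 1 ≤ lookup μ i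
IsPartition⇒positive ℓ μ (decreasing , last≥1) i = ≤-trans last≥1 (>-weakInduction AboveLast ≤-refl step i)
  where
  AboveLast : Fin (suc ℓ) → Set
  AboveLast i = lookup μ (F.fromℕ ℓ) ≤ lookup μ i
  step : ∀ i → AboveLast (F.suc i) → AboveLast (F.inject₁ i)
  step i h = ≤-trans h (decreasing i)

module Counting (ℓ : ℕ) (μ : Vec ℕ (suc ℓ)) (d : ℕ) where
  open AnchorWords ℓ μ

  𝟙-anchor : ℕ → List Letter → ℕ
  𝟙-anchor k w = 𝟙 (isAnchor ℓ μ w ∧ (bigtiles w ≡ᵇ k))

  𝟙-faultFree : ℕ → List Letter → ℕ
  𝟙-faultFree k w = 𝟙 (isAnchor ℓ μ w ∧ isFaultFree ℓ w ∧ (bigtiles w ≡ᵇ k))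

  splitsAt : List Letter → ℕ → ℕ
  splitsAt w j = 𝟙 (isAnchor ℓ μ (take j w) ∧ isFaultFree ℓ (take j w) ∧ isAnchor ℓ μ (drop j w))

  T-splitsAt : ∀ w j → T (isAnchor ℓ μ (take j w) ∧ isFaultFree ℓ (take j w) ∧ isAnchor ℓ μ (drop j w)) ⇔
               (Anchor (take j w) × FaultFree (take j w) × Anchor (drop j w))
  T-splitsAt w j = mk⇔
    (λ h → let au , fu , av = to (T-∧³ (isAnchor ℓ μ (take j w)) (isFaultFree ℓ (take j w)) (isAnchor ℓ μ (drop j w))) h
           in isAnchor⇒Anchor _ au , isFaultFree⇒FaultFree _ fu , isAnchor⇒Anchor _ av)
    (λ (au , fu , av) → from (T-∧³ (isAnchor ℓ μ (take j w)) (isFaultFree ℓ (take j w)) (isAnchor ℓ μ (drop j w)))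
                             (Anchor⇒isAnchor _ au , FaultFree⇒isFaultFree _ fu , Anchor⇒isAnchor _ av))

  sum≤-splitsAt : 1 ≤ ℓ → ∀ w → 1 ≤ length w → sum≤ (length w) (splitsAt w) ≡ 𝟙 (isAnchor ℓ μ w)
  sum≤-splitsAt ℓ≥1 w n≥1 with T? (isAnchor ℓ μ w)
  ... | yes aw with FaultFree-prefix-exists ℓ≥1 (isAnchor⇒Anchor w aw) n≥1
  ...   | j₀ , j₀≤n , au , fu = trans (sum≤-single (length w) j₀ j₀≤n others) (trans at-j₀ (sym (𝟙-T aw)))
    where
    at-j₀ : splitsAt w j₀ ≡ 1
    at-j₀ = 𝟙-T (from (T-splitsAt w j₀) (au , fu , Anchor-drop j₀ (isAnchor⇒Anchor w aw)))
    others : ∀ {j} → j ≤ length w → j ≢ j₀ → splitsAt w j ≡ 0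
    others {j} j≤n j≢j₀ = 𝟙-¬T λ h →
      j≢j₀ (FaultFree-prefix-unique ℓ≥1 j≤n j₀≤n (proj₁ (proj₂ (to (T-splitsAt w j) h))) fu)
  sum≤-splitsAt ℓ≥1 w n≥1 | no ¬aw = trans (sum≤-zero (length w) none) (sym (𝟙-¬T ¬aw))
    where
    none : ∀ {j} → j ≤ length w → splitsAt w j ≡ 0
    none {j} j≤n = 𝟙-¬T λ h →
      let au , _ , av = to (T-splitsAt w j) h
      in ¬aw (Anchor⇒isAnchor w (Anchor-join j j≤n au av))

  factorisation : 1 ≤ ℓ → ∀ w k → 1 ≤ length w →
                  sum≤ (length w) (λ j → sum≤ k (λ i → 𝟙-faultFree i (take j w) * 𝟙-anchor (k ∸ i) (drop j w)))
                  ≡ 𝟙-anchor k w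
  factorisation ℓ≥1 w k n≥1 = begin
    sum≤ (length w) (λ j → sum≤ k (λ i → 𝟙-faultFree i (take j w) * 𝟙-anchor (k ∸ i) (drop j w)))
      ≡⟨ sum≤-cong (length w) (λ {j} _ → sum≤-cong k (λ {i} _ →
           𝟙-∧-regroup (isAnchor ℓ μ (take j w)) (isFaultFree ℓ (take j w)) _ (isAnchor ℓ μ (drop j w)) _)) ⟩
    sum≤ (length w) (λ j → sum≤ k (λ i → splitsAt w j *
                              (monomial (bigtiles (take j w)) i * monomial (bigtiles (drop j w)) (k ∸ i))))
      ≡⟨ sum≤-cong (length w) (λ {j} _ → sum≤-*ˡ k (splitsAt w j) _) ⟩
    sum≤ (length w) (λ j → splitsAt w j * (monomial (bigtiles (take j w)) ·ₚ monomial (bigtiles (drop j w))) k)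
      ≡⟨ sum≤-cong (length w) (λ {j} _ → cong (splitsAt w j *_)
           (trans (monomial-·ₚ (bigtiles (take j w)) _ k) (cong (λ b → monomial b k) (bigtiles-take-drop j w)))) ⟩
    sum≤ (length w) (λ j → splitsAt w j * monomial (bigtiles w) k)
      ≡⟨ sum≤-*ʳ (length w) (monomial (bigtiles w) k) (splitsAt w) ⟩
    sum≤ (length w) (splitsAt w) * monomial (bigtiles w) k
      ≡⟨ cong (_* monomial (bigtiles w) k) (sum≤-splitsAt ℓ≥1 w n≥1) ⟩
    𝟙 (isAnchor ℓ μ w) * monomial (bigtiles w) k
      ≡⟨ 𝟙-∧ (isAnchor ℓ μ w) _ ⟨
    𝟙-anchor k w
      ∎
    where open ≡-Reasoning

  P≡count : ∀ n k → P ℓ μ d n k ≡ count d n (𝟙-anchor k)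
  P≡count n k = length-filterᵇ _ (words d n)

  α≡count : ∀ n k → α ℓ μ d n k ≡ count d n (𝟙-faultFree k)
  α≡count n k = length-filterᵇ _ (words d n)

  P-empty : ∀ k → P ℓ μ d 0 k ≡ oneₚ k
  P-empty zero    = refl
  P-empty (suc k) = refl

  P-recurrence : 1 ≤ ℓ → ∀ n → 1 ≤ n → ∀ k → P ℓ μ d n k ≡ (α ℓ μ d ⋆ P ℓ μ d) n k
  P-recurrence ℓ≥1 n n≥1 k = begin
    P ℓ μ d n k
      ≡⟨ P≡count n k ⟩
    count d n (𝟙-anchor k)
      ≡⟨ count-cong d n (λ {w} |w|≡n _ → sym (factorisation′ w |w|≡n)) ⟩
    count d n (λ w → sum≤ n (λ j → sum≤ k (λ i → 𝟙-faultFree i (take j w) * 𝟙-anchor (k ∸ i) (drop j w))))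
      ≡⟨ sum-map-sum≤ n _ (words d n) ⟩
    sum≤ n (λ j → count d n (λ w → sum≤ k (λ i → 𝟙-faultFree i (take j w) * 𝟙-anchor (k ∸ i) (drop j w))))
      ≡⟨ sum≤-cong n (λ {j} j≤n → trans (sum-map-sum≤ k _ (words d n))
                                        (sum≤-cong k (λ {i} _ → split-count j≤n i))) ⟩
    (α ℓ μ d ⋆ P ℓ μ d) n k
      ∎
    where
    open ≡-Reasoning
    factorisation′ : ∀ w → length w ≡ n →
      sum≤ n (λ j → sum≤ k (λ i → 𝟙-faultFree i (take j w) * 𝟙-anchor (k ∸ i) (drop j w))) ≡ 𝟙-anchor k w
    factorisation′ w refl = factorisation ℓ≥1 w k n≥1
    split-count : ∀ {j} → j ≤ n → ∀ i →
      count d n (λ w → 𝟙-faultFree i (take j w) * 𝟙-anchor (k ∸ i) (drop j w))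
      ≡ α ℓ μ d j i * P ℓ μ d (n ∸ j) (k ∸ i)
    split-count {j} j≤n i = begin
      count d n (λ w → 𝟙-faultFree i (take j w) * 𝟙-anchor (k ∸ i) (drop j w))
        ≡⟨ cong (λ m → count d m (λ w → 𝟙-faultFree i (take j w) * 𝟙-anchor (k ∸ i) (drop j w)))
                (m+[n∸m]≡n j≤n) ⟨
      count d (j + (n ∸ j)) (λ w → 𝟙-faultFree i (take j w) * 𝟙-anchor (k ∸ i) (drop j w))
        ≡⟨ count-take-drop d j (n ∸ j) (𝟙-faultFree i) (𝟙-anchor (k ∸ i)) ⟩
      count d j (𝟙-faultFree i) * count d (n ∸ j) (𝟙-anchor (k ∸ i))
        ≡⟨ cong₂ _*_ (α≡count j i) (P≡count (n ∸ j) (k ∸ i)) ⟨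
      α ℓ μ d j i * P ℓ μ d (n ∸ j) (k ∸ i)
        ∎

  faultFree-sound : ∀ {w k} → T (isAnchor ℓ μ w ∧ isFaultFree ℓ w ∧ (bigtiles w ≡ᵇ k)) → Anchor w × FaultFree w
  faultFree-sound {w} {k} h =
    let a , f , _ = to (T-∧³ (isAnchor ℓ μ w) (isFaultFree ℓ w) (bigtiles w ≡ᵇ k)) h
    in isAnchor⇒Anchor w a , isFaultFree⇒FaultFree w f

  α-one : 1 ≤ ℓ → ∀ k → α ℓ μ d 1 k ≡ oneₚ k
  α-one ℓ≥1 k = begin
    α ℓ μ d 1 k
      ≡⟨ α≡count 1 k ⟩
    count d 1 (𝟙-faultFree k)
      ≡⟨ count-suc d 0 (𝟙-faultFree k) ⟩
    (𝟙-faultFree k (∞ ∷ []) + 0) + sum (map single finiteLetters)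
      ≡⟨ cong₂ _+_ (+-identityʳ _) finite-rejected ⟩
    𝟙-faultFree k (∞ ∷ []) + 0
      ≡⟨ +-identityʳ _ ⟩
    𝟙 (isAnchor ℓ μ (∞ ∷ []) ∧ isFaultFree ℓ (∞ ∷ []) ∧ (0 ≡ᵇ k))
      ≡⟨ cong (λ b → 𝟙 (b ∧ isFaultFree ℓ (∞ ∷ []) ∧ (0 ≡ᵇ k))) (to T-≡ (Anchor⇒isAnchor _ Anchor-[∞])) ⟩
    monomial 0 k
      ≡⟨ monomial-zero k ⟩
    oneₚ k
      ∎
    where
    open ≡-Reasoning
    single : Letter → ℕ
    single a = count d 0 (λ w → 𝟙-faultFree k (a ∷ w))
    finiteLetters : List Letter
    finiteLetters = applyUpTo (λ i → fin (suc i)) d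
    rejected : ∀ i → single (fin (suc i)) ≡ 0
    rejected i = trans (+-identityʳ _) (𝟙-¬T λ h →
      ≤⇒≯ ℓ≥1 (Anchor-fin⇒ℓ< (proj₁ (faultFree-sound {fin (suc i) ∷ []} {k} h))))
    finite-rejected : sum (map single finiteLetters) ≡ 0
    finite-rejected = trans (cong sum (map-cong-local {g = λ _ → 0} (applyUpTo⁺₂ _ d rejected)))
                            (sum-map-zero finiteLetters)

  α-vanishes : 1 ≤ ℓ → (∀ k → 1 ≤ lookup μ (F.suc k)) → ∀ {j} → ℓ * d + 1 < j → ∀ k → α ℓ μ d j k ≡ 0
  α-vanishes ℓ≥1 μ⁺ {j} ℓd+1<j k =
    trans (α≡count j k) (trans (count-cong d j (λ {w} |w|≡j letters → 𝟙-¬T (too-long |w|≡j letters)))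
                               (sum-map-zero (words d j)))
    where
    too-long : ∀ {w} → length w ≡ j → All (LetterIn d) w →
               ¬ T (isAnchor ℓ μ w ∧ isFaultFree ℓ w ∧ (bigtiles w ≡ᵇ k))
    too-long {w} |w|≡j letters h =
      let a , f = faultFree-sound {w} {k} h
      in <⇒≱ ℓd+1<j (subst (_≤ ℓ * d + 1) |w|≡j (FaultFree-length ℓ≥1 μ⁺ a f letters))

theorem4p13 : (ℓ : ℕ) (μ : Vec ℕ (suc ℓ)) (d : ℕ) →
    IsPartition ℓ μ → 1 ≤ ℓ → 1 ≤ d → d ≤ lookup μ zero →
    ((n k : ℕ) → (Fser ℓ μ d *ˢ (oneˢ -ˢ Bser ℓ μ d)) n k ≡ oneˢ n k)
    × ((k : ℕ) → α ℓ μ d 1 k ≡ oneₚ k)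
    × ((j : ℕ) → ℓ * d + 1 < j → (k : ℕ) → α ℓ μ d j k ≡ 0)
    × ((n : ℕ) → 1 ≤ n → (k : ℕ) →
         P ℓ μ d n k ≡ sum1to (ℓ * d + 1) (λ j → α ℓ μ d j ·ₚ Pshift ℓ μ d n j) k)
theorem4p13 ℓ μ d partition ℓ≥1 _ _ =
    *ˢ-inverse (P ℓ μ d) (α ℓ μ d) P-empty (λ _ → refl) (P-recurrence ℓ≥1)
  , α-one ℓ≥1
  , (λ _ → α-vanishes ℓ≥1 μ⁺)
  , λ n n≥1 k → trans (P-recurrence ℓ≥1 n n≥1 k)
                      (⋆≡sum1to-shift (α ℓ μ d) (P ℓ μ d) (ℓ * d + 1) n k (λ _ → refl) (α-vanishes ℓ≥1 μ⁺))
  where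
  open Counting ℓ μ d
  μ⁺ : ∀ k → 1 ≤ lookup μ (F.suc k)
  μ⁺ k = IsPartition⇒positive ℓ μ partition (F.suc k)
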